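{- Let $G_1,G_2$ be vertex-disjoint graphs with $\mathcal{I}(G_1)\cong H_1$ and $\mathcal{I}(G_2)\cong H_2$. Then $\mathcal{I}(G_1\cup G_2)\cong H_1\,\square\,H_2$, where $G_1\cup G_2$ is the disjoint union and $\square$ denotes the Cartesian product of graphs.
   Context: All graphs are finite and simple. For a graph $G$, $i(G)$ denotes the minimum cardinality of an independent dominating set of $G$; an independent dominating set of cardinality $i(G)$ is an $i$-set of $G$. The $i$-graph $\mathcal{I}(G)$ of $G$ is the graph whose vertices are the $i$-sets of $G$, where two $i$-sets $S$ and $S'$ are adjacent if and only if there is an edge $xy\in E(G)$ with $S'=(S-\{x\})\cup\{y\}$. -}

module Defs where

open import Data.Nat using (ℕ; _+_; _≤_; _≤?_)
open import Data.Fin using (Fin; splitAt)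
open import Data.Fin.Subset using (Subset; _∈_; _∉_; _-_; _∪_; ⁅_⁆; ∣_∣)
open import Data.Fin.Subset.Properties using (_∈?_; anySubset?)
open import Data.Fin.Properties using (all?; any?)
open import Data.Bool using (Bool; true; false)
open import Data.Bool.Properties using () renaming (_≟_ to _≟ᵇ_)
open import Data.Product using (Σ; ∃; ∃-syntax; _×_; _,_)
open import Data.Sum using (_⊎_; inj₁; inj₂)
open import Relation.Nullary using (¬_; Dec; yes; no)
open import Relation.Nullary.Decidable using (True; _×-dec_; _⊎-dec_; ¬?; decidable-stable)
open import Relation.Binary.PropositionalEquality using (_≡_; refl)
open import Function.Bundles using (_↔_)

record FinGraph : Set where
  field
    n     : ℕ
    adj   : Fin n → Fin n → Bool
    sym   : ∀ x y → adj x y ≡ adj y x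
    irr   : ∀ x → adj x x ≡ false

open FinGraph public

Adj : (G : FinGraph) → Fin (n G) → Fin (n G) → Set
Adj G x y = adj G x y ≡ true

Independent : (G : FinGraph) → Subset (n G) → Set
Independent G S = ∀ x y → x ∈ S → y ∈ S → ¬ Adj G x y

Dominating : (G : FinGraph) → Subset (n G) → Set
Dominating G S = ∀ x → x ∈ S ⊎ (∃[ y ] (y ∈ S × Adj G x y))

IndependentDominating : (G : FinGraph) → Subset (n G) → Set
IndependentDominating G S = Independent G S × Dominating G S

IsISet : (G : FinGraph) → Subset (n G) → Set
IsISet G S = IndependentDominating G S
           × (∀ T → IndependentDominating G T → ∣ S ∣ ≤ ∣ T ∣)

-- Decidability of being an i-set (used only so that the vertex type of
-- the i-graph has proof-irrelevant membership witnesses).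
private
  adj? : (G : FinGraph) → ∀ x y → Dec (Adj G x y)
  adj? G x y = adj G x y ≟ᵇ true

  ∀Subset? : ∀ {m} {P : Subset m → Set} → (∀ S → Dec (P S)) → Dec (∀ S → P S)
  ∀Subset? {P = P} P? with anySubset? (λ S → ¬? (P? S))
  ... | yes (S , ¬p) = no (λ h → ¬p (h S))
  ... | no  h        = yes (λ S → decidable-stable (P? S) (λ ¬p → h (S , ¬p)))

  →? : ∀ {A B : Set} → Dec A → Dec B → Dec (A → B)
  →? _ (yes b) = yes (λ _ → b)
  →? (yes a) (no ¬b) = no (λ f → ¬b (f a))
  →? (no ¬a) _ = yes (λ a → Data.Empty.⊥-elim (¬a a))
    where import Data.Empty

  indep? : (G : FinGraph) → ∀ S → Dec (Independent G S)
  indep? G S = all? λ x → all? λ y →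
    →? (x ∈? S) (→? (y ∈? S) (¬? (adj? G x y)))

  dom? : (G : FinGraph) → ∀ S → Dec (Dominating G S)
  dom? G S = all? λ x → (x ∈? S) ⊎-dec any? (λ y → (y ∈? S) ×-dec adj? G x y)

  indDom? : (G : FinGraph) → ∀ S → Dec (IndependentDominating G S)
  indDom? G S = indep? G S ×-dec dom? G S

isISet? : (G : FinGraph) → ∀ S → Dec (IsISet G S)
isISet? G S = indDom? G S ×-dec ∀Subset? (λ T → →? (indDom? G T) (∣ S ∣ ≤? ∣ T ∣))

record Graph : Set₁ where
  field
    V : Set
    E : V → V → Set

open Graph public

record _≅_ (G H : Graph) : Set where
  field
    bij  : V G ↔ V H
  open Function.Bundles.Inverse bij public using (to; from)
  field
    edges : ∀ a b → (E G a b → E H (to a) (to b)) × (E H (to a) (to b) → E G a b)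

iGraph : FinGraph → Graph
iGraph G = record
  { V = Σ (Subset (n G)) (λ S → True (isISet? G S))
  ; E = λ { (S , _) (S' , _) →
        ∃[ x ] ∃[ y ] (Adj G x y × x ∈ S × y ∉ S × S' ≡ ((S - x) ∪ ⁅ y ⁆)) }
  }

-- Disjoint union G₁ ∪ G₂ on vertex set Fin (n₁ + n₂): the first n₁ vertices
-- are G₁'s, the remaining n₂ are G₂'s; no edges between the two parts.
private
  uadj : (G₁ G₂ : FinGraph) → Fin (n G₁ + n G₂) → Fin (n G₁ + n G₂) → Bool
  uadj G₁ G₂ x y with splitAt (n G₁) x | splitAt (n G₁) y
  ... | inj₁ a | inj₁ b = adj G₁ a b
  ... | inj₂ a | inj₂ b = adj G₂ a b
  ... | inj₁ _ | inj₂ _ = false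
  ... | inj₂ _ | inj₁ _ = false

  usym : (G₁ G₂ : FinGraph) → ∀ x y → uadj G₁ G₂ x y ≡ uadj G₁ G₂ y x
  usym G₁ G₂ x y with splitAt (n G₁) x | splitAt (n G₁) y
  ... | inj₁ a | inj₁ b = sym G₁ a b
  ... | inj₂ a | inj₂ b = sym G₂ a b
  ... | inj₁ _ | inj₂ _ = refl
  ... | inj₂ _ | inj₁ _ = refl

  uirr : (G₁ G₂ : FinGraph) → ∀ x → uadj G₁ G₂ x x ≡ false
  uirr G₁ G₂ x with splitAt (n G₁) x
  ... | inj₁ a = irr G₁ a
  ... | inj₂ a = irr G₂ a

_⊎ᴳ_ : FinGraph → FinGraph → FinGraph
G₁ ⊎ᴳ G₂ = record
  { n = n G₁ + n G₂ ; adj = uadj G₁ G₂ ; sym = usym G₁ G₂ ; irr = uirr G₁ G₂ }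

_□_ : Graph → Graph → Graph
H₁ □ H₂ = record
  { V = V H₁ × V H₂
  ; E = λ { (a , b) (a' , b') →
        (E H₁ a a' × b ≡ b') ⊎ (a ≡ a' × E H₂ b b') }
  }

-- A subset of V(G₁ ∪ G₂) is a pair (A, B) of subsets of V(G₁) and V(G₂), and as
-- there are no edges between the parts it is independent and dominating iff A and B
-- are. Hence i(G₁ ∪ G₂) = i(G₁) + i(G₂), and the i-sets of G₁ ∪ G₂ are exactly the
-- pairs of an i-set of G₁ and an i-set of G₂. An edge of 𝓘(G₁ ∪ G₂) slides a token
-- along an edge of G₁ ∪ G₂, which lies inside one part, so it changes exactly one of
-- A and B, by an edge of that part's i-graph: this is a Cartesian-product edge.
module Submission where

open import Defs hiding (sym)
open import Data.Nat using (ℕ; zero; suc; _+_; _≤_)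
open import Data.Nat.Properties using (+-mono-≤; +-cancelʳ-≤; +-cancelˡ-≤)
open import Data.Fin using (Fin; splitAt; _↑ˡ_; _↑ʳ_)
open import Data.Fin.Properties
  using (splitAt-↑ˡ; splitAt-↑ʳ; splitAt⁻¹-↑ˡ; splitAt⁻¹-↑ʳ)
open import Data.Fin.Subset
  using (Subset; _∈_; _∉_; _-_; _─_; _∪_; ⁅_⁆; ⊥; ∣_∣; inside; outside)
open import Data.Fin.Subset.Properties using (p─⊥≡p; ∪-identityʳ)
open import Data.Vec using ([]; _∷_; _++_; take; drop; here; there)
open import Data.Vec.Properties
  using (zipWith-++; take++drop≡id; ++-injective; ++-injectiveˡ; ++-injectiveʳ)
open import Data.Bool.Properties using (T-irrelevant)
open import Data.Empty using (⊥-elim)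
open import Data.Product using (∃-syntax; _×_; _,_; proj₁; proj₂; map₁; map₂)
import Data.Product as Product
open import Data.Product.Function.NonDependent.Propositional using (_×-↔_)
open import Data.Sum using (_⊎_; inj₁; inj₂)
import Data.Sum as Sum
open import Function using (_∘_)
open import Function.Bundles using (Inverse; Injection; mk↔ₛ′)
open import Function.Properties.Inverse using (↔-sym; ↔-trans; Inverse⇒Injection)
open import Relation.Nullary using (¬_)
open import Relation.Nullary.Decidable using (True; toWitness; fromWitness)
open import Relation.Binary.PropositionalEquality

module _ {G H : Graph} (φ : G ≅ H) where
  open _≅_ φ

  to∘from : ∀ b → to (from b) ≡ b
  to∘from = Inverse.strictlyInverseˡ bij

  to-injective : ∀ {a a'} → to a ≡ to a' → a ≡ a'
  to-injective = Injection.injective (Inverse⇒Injection bij)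

≅-sym : {G H : Graph} → G ≅ H → H ≅ G
≅-sym {G} {H} φ = record
  { bij = ↔-sym bij ; edges = λ a b → reflect a b , preserve a b }
  where
  open _≅_ φ
  reflect : ∀ a b → E H a b → E G (from a) (from b)
  reflect a b e = proj₂ (edges (from a) (from b))
    (subst₂ (E H) (sym (to∘from φ a)) (sym (to∘from φ b)) e)

  preserve : ∀ a b → E G (from a) (from b) → E H a b
  preserve a b e = subst₂ (E H) (to∘from φ a) (to∘from φ b)
    (proj₁ (edges (from a) (from b)) e)

≅-trans : {G H K : Graph} → G ≅ H → H ≅ K → G ≅ K
≅-trans φ ψ = record
  { bij   = ↔-trans Φ.bij Ψ.bij
  ; edges = λ a b → proj₁ (Ψ.edges _ _) ∘ proj₁ (Φ.edges a b)
                  , proj₂ (Φ.edges a b) ∘ proj₂ (Ψ.edges _ _)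
  }
  where
  module Φ = _≅_ φ
  module Ψ = _≅_ ψ

□-cong : {G₁ G₂ H₁ H₂ : Graph} → G₁ ≅ H₁ → G₂ ≅ H₂ → (G₁ □ G₂) ≅ (H₁ □ H₂)
□-cong φ ψ = record
  { bij   = Φ.bij ×-↔ Ψ.bij
  ; edges = λ { (a , b) (a' , b') →
        Sum.map (Product.map (proj₁ (Φ.edges a a')) (cong Ψ.to))
                (Product.map (cong Φ.to) (proj₁ (Ψ.edges b b')))
      , Sum.map (Product.map (proj₂ (Φ.edges a a')) (to-injective ψ))
                (Product.map (to-injective φ) (proj₂ (Ψ.edges b b'))) }
  }
  where
  module Φ = _≅_ φ
  module Ψ = _≅_ ψ

private variable k l : ℕ

data SplitView (k l : ℕ) : Fin (k + l) → Set where
  inl : ∀ a → SplitView k l (a ↑ˡ l)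
  inr : ∀ b → SplitView k l (k ↑ʳ b)

splitView : ∀ k l x → SplitView k l x
splitView k l x with splitAt k {l} x in eq
... | inj₁ a = subst (SplitView k l) (splitAt⁻¹-↑ˡ eq) (inl a)
... | inj₂ b = subst (SplitView k l) (splitAt⁻¹-↑ʳ eq) (inr b)

∈-++⁺ˡ : ∀ {A : Subset k} {B : Subset l} {a} → a ∈ A → a ↑ˡ l ∈ A ++ B
∈-++⁺ˡ here      = here
∈-++⁺ˡ (there p) = there (∈-++⁺ˡ p)

∈-++⁻ˡ : ∀ (A : Subset k) {B : Subset l} {a} → a ↑ˡ l ∈ A ++ B → a ∈ A
∈-++⁻ˡ (_ ∷ _) {a = Fin.zero}  here      = here
∈-++⁻ˡ (_ ∷ A) {a = Fin.suc a} (there p) = there (∈-++⁻ˡ A p)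

∈-++⁺ʳ : ∀ (A : Subset k) {B : Subset l} {b} → b ∈ B → k ↑ʳ b ∈ A ++ B
∈-++⁺ʳ []      p = p
∈-++⁺ʳ (_ ∷ A) p = there (∈-++⁺ʳ A p)

∈-++⁻ʳ : ∀ (A : Subset k) {B : Subset l} {b} → k ↑ʳ b ∈ A ++ B → b ∈ B
∈-++⁻ʳ []      p         = p
∈-++⁻ʳ (_ ∷ A) (there p) = ∈-++⁻ʳ A p

∣p++q∣≡∣p∣+∣q∣ : ∀ (A : Subset k) (B : Subset l) →
                 ∣ A ++ B ∣ ≡ ∣ A ∣ + ∣ B ∣
∣p++q∣≡∣p∣+∣q∣ []            B = refl
∣p++q∣≡∣p∣+∣q∣ (inside ∷ A)  B = cong suc (∣p++q∣≡∣p∣+∣q∣ A B)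
∣p++q∣≡∣p∣+∣q∣ (outside ∷ A) B = ∣p++q∣≡∣p∣+∣q∣ A B

⊥≡⊥++⊥ : ∀ k → ⊥ {k + l} ≡ ⊥ {k} ++ ⊥ {l}
⊥≡⊥++⊥ zero    = refl
⊥≡⊥++⊥ (suc k) = cong (outside ∷_) (⊥≡⊥++⊥ k)

⁅↑ˡ⁆≡⁅⁆++⊥ : ∀ (a : Fin k) → ⁅ a ↑ˡ l ⁆ ≡ ⁅ a ⁆ ++ ⊥
⁅↑ˡ⁆≡⁅⁆++⊥ {suc k} Fin.zero    = cong (inside ∷_) (⊥≡⊥++⊥ k)
⁅↑ˡ⁆≡⁅⁆++⊥         (Fin.suc a) = cong (outside ∷_) (⁅↑ˡ⁆≡⁅⁆++⊥ a)

⁅↑ʳ⁆≡⊥++⁅⁆ : ∀ k (b : Fin l) → ⁅ k ↑ʳ b ⁆ ≡ ⊥ ++ ⁅ b ⁆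
⁅↑ʳ⁆≡⊥++⁅⁆ zero    b = refl
⁅↑ʳ⁆≡⊥++⁅⁆ (suc k) b = cong (outside ∷_) (⁅↑ʳ⁆≡⊥++⁅⁆ k b)

slide : Subset k → Fin k → Fin k → Subset k
slide S x y = (S - x) ∪ ⁅ y ⁆

slide-++ˡ : ∀ (A : Subset k) (B : Subset l) x y →
            slide (A ++ B) (x ↑ˡ l) (y ↑ˡ l) ≡ slide A x y ++ B
slide-++ˡ A B x y = begin
  ((A ++ B) ─ ⁅ x ↑ˡ _ ⁆) ∪ ⁅ y ↑ˡ _ ⁆
    ≡⟨ cong₂ (λ X Y → ((A ++ B) ─ X) ∪ Y) (⁅↑ˡ⁆≡⁅⁆++⊥ x) (⁅↑ˡ⁆≡⁅⁆++⊥ y) ⟩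
  ((A ++ B) ─ (⁅ x ⁆ ++ ⊥)) ∪ (⁅ y ⁆ ++ ⊥)
    ≡⟨ cong (_∪ (⁅ y ⁆ ++ ⊥)) (zipWith-++ _ A B ⁅ x ⁆ ⊥) ⟩
  ((A - x) ++ (B ─ ⊥)) ∪ (⁅ y ⁆ ++ ⊥)
    ≡⟨ zipWith-++ _ (A - x) (B ─ ⊥) ⁅ y ⁆ ⊥ ⟩
  slide A x y ++ ((B ─ ⊥) ∪ ⊥)
    ≡⟨ cong (slide A x y ++_) (trans (∪-identityʳ (B ─ ⊥)) (p─⊥≡p B)) ⟩
  slide A x y ++ B
    ∎
  where open ≡-Reasoning

slide-++ʳ : ∀ (A : Subset k) (B : Subset l) x y →
            slide (A ++ B) (k ↑ʳ x) (k ↑ʳ y) ≡ A ++ slide B x y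
slide-++ʳ {k} A B x y = begin
  ((A ++ B) ─ ⁅ k ↑ʳ x ⁆) ∪ ⁅ k ↑ʳ y ⁆
    ≡⟨ cong₂ (λ X Y → ((A ++ B) ─ X) ∪ Y) (⁅↑ʳ⁆≡⊥++⁅⁆ k x) (⁅↑ʳ⁆≡⊥++⁅⁆ k y) ⟩
  ((A ++ B) ─ (⊥ ++ ⁅ x ⁆)) ∪ (⊥ ++ ⁅ y ⁆)
    ≡⟨ cong (_∪ (⊥ ++ ⁅ y ⁆)) (zipWith-++ _ A B ⊥ ⁅ x ⁆) ⟩
  ((A ─ ⊥) ++ (B - x)) ∪ (⊥ ++ ⁅ y ⁆)
    ≡⟨ zipWith-++ _ (A ─ ⊥) (B - x) ⊥ ⁅ y ⁆ ⟩
  ((A ─ ⊥) ∪ ⊥) ++ slide B x y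
    ≡⟨ cong (_++ slide B x y) (trans (∪-identityʳ (A ─ ⊥)) (p─⊥≡p A)) ⟩
  A ++ slide B x y
    ∎
  where open ≡-Reasoning

∀-++ : ∀ {P : Subset (k + l) → Set} → (∀ A B → P (A ++ B)) → ∀ S → P S
∀-++ {k} {P = P} h S = subst P (take++drop≡id k S) (h (take k S) (drop k S))

take-++ : ∀ (A : Subset k) (B : Subset l) → take k (A ++ B) ≡ A
take-++ {k} A B = ++-injectiveˡ _ A (take++drop≡id k (A ++ B))

drop-++ : ∀ (A : Subset k) (B : Subset l) → drop k (A ++ B) ≡ B
drop-++ {k} A B = ++-injectiveʳ _ A (take++drop≡id k (A ++ B))

-- An edge from (S , _) to (S' , _) in iGraph G is literally Slide G S S'.
Slide : (G : FinGraph) → Subset (n G) → Subset (n G) → Set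
Slide G S S' = ∃[ x ] ∃[ y ] (Adj G x y × x ∈ S × y ∉ S × S' ≡ slide S x y)

iSet-≡ : ∀ G {S S'} {p : True (isISet? G S)} {p' : True (isISet? G S')}
       → S ≡ S' → _≡_ {A = V (iGraph G)} (S , p) (S' , p')
iSet-≡ G {p = p} {p'} refl = cong (_ ,_) (T-irrelevant p p')

module Union (G₁ G₂ : FinGraph) where
  private
    n₁ = n G₁
    n₂ = n G₂
    U  = G₁ ⊎ᴳ G₂

  adj-↑ˡ : ∀ a b → adj U (a ↑ˡ n₂) (b ↑ˡ n₂) ≡ adj G₁ a b
  adj-↑ˡ a b rewrite splitAt-↑ˡ n₁ a n₂ | splitAt-↑ˡ n₁ b n₂ = refl

  adj-↑ʳ : ∀ a b → adj U (n₁ ↑ʳ a) (n₁ ↑ʳ b) ≡ adj G₂ a b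
  adj-↑ʳ a b rewrite splitAt-↑ʳ n₁ n₂ a | splitAt-↑ʳ n₁ n₂ b = refl

  ¬Adj-↑ˡ-↑ʳ : ∀ a b → ¬ Adj U (a ↑ˡ n₂) (n₁ ↑ʳ b)
  ¬Adj-↑ˡ-↑ʳ a b rewrite splitAt-↑ˡ n₁ a n₂ | splitAt-↑ʳ n₁ n₂ b = λ ()

  ¬Adj-↑ʳ-↑ˡ : ∀ a b → ¬ Adj U (n₁ ↑ʳ a) (b ↑ˡ n₂)
  ¬Adj-↑ʳ-↑ˡ a b rewrite splitAt-↑ʳ n₁ n₂ a | splitAt-↑ˡ n₁ b n₂ = λ ()

  module _ {A : Subset n₁} {B : Subset n₂} where

    independent-++⁺ : Independent G₁ A → Independent G₂ B → Independent U (A ++ B)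
    independent-++⁺ indA indB x y with splitView n₁ n₂ x | splitView n₁ n₂ y
    ... | inl a | inl b = λ a∈ b∈ →
      indA a b (∈-++⁻ˡ A a∈) (∈-++⁻ˡ A b∈) ∘ trans (sym (adj-↑ˡ a b))
    ... | inr a | inr b = λ a∈ b∈ →
      indB a b (∈-++⁻ʳ A a∈) (∈-++⁻ʳ A b∈) ∘ trans (sym (adj-↑ʳ a b))
    ... | inl a | inr b = λ _ _ → ¬Adj-↑ˡ-↑ʳ a b
    ... | inr a | inl b = λ _ _ → ¬Adj-↑ʳ-↑ˡ a b

    independent-++⁻ : Independent U (A ++ B) → Independent G₁ A × Independent G₂ B
    independent-++⁻ ind =
        (λ a b a∈ b∈ → ind _ _ (∈-++⁺ˡ a∈)   (∈-++⁺ˡ b∈)   ∘ trans (adj-↑ˡ a b))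
      , (λ a b a∈ b∈ → ind _ _ (∈-++⁺ʳ A a∈) (∈-++⁺ʳ A b∈) ∘ trans (adj-↑ʳ a b))

    dominating-++⁺ : Dominating G₁ A → Dominating G₂ B → Dominating U (A ++ B)
    dominating-++⁺ domA domB x with splitView n₁ n₂ x
    ... | inl a = Sum.map ∈-++⁺ˡ
                    (λ (b , b∈ , e) → b ↑ˡ n₂ , ∈-++⁺ˡ b∈ , trans (adj-↑ˡ a b) e) (domA a)
    ... | inr a = Sum.map (∈-++⁺ʳ A)
                    (λ (b , b∈ , e) → n₁ ↑ʳ b , ∈-++⁺ʳ A b∈ , trans (adj-↑ʳ a b) e) (domB a)

    dominating-++⁻ˡ : Dominating U (A ++ B) → Dominating G₁ A
    dominating-++⁻ˡ dom a with dom (a ↑ˡ n₂)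
    ... | inj₁ a∈ = inj₁ (∈-++⁻ˡ A a∈)
    ... | inj₂ (y , y∈ , e) with splitView n₁ n₂ y
    ...   | inl b = inj₂ (b , ∈-++⁻ˡ A y∈ , trans (sym (adj-↑ˡ a b)) e)
    ...   | inr b = ⊥-elim (¬Adj-↑ˡ-↑ʳ a b e)

    dominating-++⁻ʳ : Dominating U (A ++ B) → Dominating G₂ B
    dominating-++⁻ʳ dom a with dom (n₁ ↑ʳ a)
    ... | inj₁ a∈ = inj₁ (∈-++⁻ʳ A a∈)
    ... | inj₂ (y , y∈ , e) with splitView n₁ n₂ y
    ...   | inl b = ⊥-elim (¬Adj-↑ʳ-↑ˡ a b e)
    ...   | inr b = inj₂ (b , ∈-++⁻ʳ A y∈ , trans (sym (adj-↑ʳ a b)) e)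

    indDom-++⁺ : IndependentDominating G₁ A → IndependentDominating G₂ B →
                 IndependentDominating U (A ++ B)
    indDom-++⁺ (indA , domA) (indB , domB) =
      independent-++⁺ indA indB , dominating-++⁺ domA domB

    indDom-++⁻ : IndependentDominating U (A ++ B) →
                 IndependentDominating G₁ A × IndependentDominating G₂ B
    indDom-++⁻ (ind , dom) with independent-++⁻ ind
    ... | indA , indB = (indA , dominating-++⁻ˡ dom) , (indB , dominating-++⁻ʳ dom)

  isISet-++⁺ : ∀ {A B} → IsISet G₁ A → IsISet G₂ B → IsISet U (A ++ B)
  isISet-++⁺ {A} {B} (dA , minA) (dB , minB) = indDom-++⁺ dA dB , ∀-++ minimal
    where
    minimal : ∀ T₁ T₂ → IndependentDominating U (T₁ ++ T₂) → ∣ A ++ B ∣ ≤ ∣ T₁ ++ T₂ ∣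
    minimal T₁ T₂ dT with indDom-++⁻ dT
    ... | dT₁ , dT₂ = subst₂ _≤_ (sym (∣p++q∣≡∣p∣+∣q∣ A B)) (sym (∣p++q∣≡∣p∣+∣q∣ T₁ T₂))
                        (+-mono-≤ (minA T₁ dT₁) (minB T₂ dT₂))

  -- Replacing one half of an i-set by a smaller independent dominating set would
  -- give a smaller independent dominating set of G₁ ∪ G₂.
  isISet-++⁻ : ∀ {A B} → IsISet U (A ++ B) → IsISet G₁ A × IsISet G₂ B
  isISet-++⁻ {A} {B} (d , min) with indDom-++⁻ d
  ... | dA , dB = (dA , minimalˡ) , (dB , minimalʳ)
    where
    minimalˡ : ∀ T → IndependentDominating G₁ T → ∣ A ∣ ≤ ∣ T ∣
    minimalˡ T dT = +-cancelʳ-≤ (∣ B ∣) (∣ A ∣) (∣ T ∣)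
      (subst₂ _≤_ (∣p++q∣≡∣p∣+∣q∣ A B) (∣p++q∣≡∣p∣+∣q∣ T B)
        (min (T ++ B) (indDom-++⁺ dT dB)))

    minimalʳ : ∀ T → IndependentDominating G₂ T → ∣ B ∣ ≤ ∣ T ∣
    minimalʳ T dT = +-cancelˡ-≤ (∣ A ∣) (∣ B ∣) (∣ T ∣)
      (subst₂ _≤_ (∣p++q∣≡∣p∣+∣q∣ A B) (∣p++q∣≡∣p∣+∣q∣ A T)
        (min (A ++ T) (indDom-++⁺ dA dT)))

  Slide-++⁺ˡ : ∀ {A A' B} → Slide G₁ A A' → Slide U (A ++ B) (A' ++ B)
  Slide-++⁺ˡ {A} {B = B} (x , y , e , x∈ , y∉ , refl) =
    x ↑ˡ n₂ , y ↑ˡ n₂ , trans (adj-↑ˡ x y) e , ∈-++⁺ˡ x∈ , y∉ ∘ ∈-++⁻ˡ A ,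
    sym (slide-++ˡ A B x y)

  Slide-++⁺ʳ : ∀ {A B B'} → Slide G₂ B B' → Slide U (A ++ B) (A ++ B')
  Slide-++⁺ʳ {A} {B} (x , y , e , x∈ , y∉ , refl) =
    n₁ ↑ʳ x , n₁ ↑ʳ y , trans (adj-↑ʳ x y) e , ∈-++⁺ʳ A x∈ , y∉ ∘ ∈-++⁻ʳ A ,
    sym (slide-++ʳ A B x y)

  Slide-++⁻ : ∀ {A A' B B'} → Slide U (A ++ B) (A' ++ B')
            → (Slide G₁ A A' × B ≡ B') ⊎ (A ≡ A' × Slide G₂ B B')
  Slide-++⁻ {A} {A'} {B} {B'} (x , y , e , x∈ , y∉ , eq)
    with splitView n₁ n₂ x | splitView n₁ n₂ y
  ... | inl a | inl b = inj₁ (slideˡ , sym (proj₂ halves))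
    where
    halves : A' ≡ slide A a b × B' ≡ B
    halves = ++-injective A' _ (trans eq (slide-++ˡ A B a b))

    slideˡ : Slide G₁ A A'
    slideˡ = a , b , trans (sym (adj-↑ˡ a b)) e , ∈-++⁻ˡ A x∈ , y∉ ∘ ∈-++⁺ˡ , proj₁ halves
  ... | inr a | inr b = inj₂ (sym (proj₁ halves) , slideʳ)
    where
    halves : A' ≡ A × B' ≡ slide B a b
    halves = ++-injective A' A (trans eq (slide-++ʳ A B a b))

    slideʳ : Slide G₂ B B'
    slideʳ = a , b , trans (sym (adj-↑ʳ a b)) e , ∈-++⁻ʳ A x∈ , y∉ ∘ ∈-++⁺ʳ A , proj₂ halves
  ... | inl a | inr b = ⊥-elim (¬Adj-↑ˡ-↑ʳ a b e)
  ... | inr a | inl b = ⊥-elim (¬Adj-↑ʳ-↑ˡ a b e)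

  iGraph-⊎ : (iGraph G₁ □ iGraph G₂) ≅ iGraph U
  iGraph-⊎ = record
    { bij   = mk↔ₛ′ join split join∘split split∘join
    ; edges = λ X Y → preserve X Y , reflect X Y
    }
    where
    join : V (iGraph G₁ □ iGraph G₂) → V (iGraph U)
    join ((A , p) , (B , q)) = A ++ B , fromWitness (isISet-++⁺ (toWitness p) (toWitness q))

    split : V (iGraph U) → V (iGraph G₁ □ iGraph G₂)
    split (S , p) =
      (take n₁ S , fromWitness (proj₁ halves)) , (drop n₁ S , fromWitness (proj₂ halves))
      where
      halves : IsISet G₁ (take n₁ S) × IsISet G₂ (drop n₁ S)
      halves = isISet-++⁻ (subst (IsISet U) (sym (take++drop≡id n₁ S)) (toWitness p))

    join∘split : ∀ S → join (split S) ≡ S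
    join∘split (S , _) = iSet-≡ U (take++drop≡id n₁ S)

    split∘join : ∀ X → split (join X) ≡ X
    split∘join ((A , _) , (B , _)) =
      cong₂ _,_ (iSet-≡ G₁ (take-++ A B)) (iSet-≡ G₂ (drop-++ A B))

    preserve : ∀ X Y → E (iGraph G₁ □ iGraph G₂) X Y → E (iGraph U) (join X) (join Y)
    preserve _ _ (inj₁ (s , refl)) = Slide-++⁺ˡ s
    preserve _ _ (inj₂ (refl , s)) = Slide-++⁺ʳ s

    reflect : ∀ X Y → E (iGraph U) (join X) (join Y) → E (iGraph G₁ □ iGraph G₂) X Y
    reflect _ _ = Sum.map (map₂ (iSet-≡ G₂)) (map₁ (iSet-≡ G₁)) ∘ Slide-++⁻

proposition4p3 : (G₁ G₂ : FinGraph) (H₁ H₂ : Graph)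
    → iGraph G₁ ≅ H₁ → iGraph G₂ ≅ H₂
    → iGraph (G₁ ⊎ᴳ G₂) ≅ (H₁ □ H₂)
proposition4p3 G₁ G₂ H₁ H₂ φ₁ φ₂ =
  ≅-trans (≅-sym (Union.iGraph-⊎ G₁ G₂)) (□-cong φ₁ φ₂)
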